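{- Let $\beta\in\mathbb{N}$ with $\beta\le n$, and let $P_1,\dots,P_m\in\mathbb{F}_q[X_1,\dots,X_n]$ be polynomials of total degree at most $d$. Sample independently and uniformly at random coefficients $\rho_{i,k}\in\mathbb{F}_q$ for $i\in[\beta+2]$, $k\in[m]$, and set $\widetilde P_i\coloneqq\sum_{k=1}^m\rho_{i,k}P_k$ for $i\in[\beta+2]$. Define \[\widetilde F\coloneqq\prod_{i=1}^{\beta+2}(1-\widetilde P_i^{\,q-1}),\qquad \widetilde Z_\beta(Y_1,\dots,Y_{n-\beta})\coloneqq\sum_{z\in\mathbb{F}_q^\beta}\widetilde F(Y_1,\dots,Y_{n-\beta},z).\] Then for every $y\in\mathbb{F}_q^{n-\beta}$, $\Pr\left(\widetilde Z_\beta(y)\neq Z_\beta(y)\right)\le q^{ -2}$.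
   Context: $q$ is a prime power. $F\coloneqq\prod_{i=1}^m(1-P_i^{q-1})$ and $Z_\beta(Y_1,\dots,Y_{n-\beta})\coloneqq\sum_{z\in\mathbb{F}_q^\beta}F(Y_1,\dots,Y_{n-\beta},z)$. -}

module Defs where

open import Level using (Level; _⊔_) renaming (suc to lsuc)
open import Data.Nat as ℕ using (ℕ; zero; suc; _≤_)
open import Data.Fin using (Fin; zero; suc)
open import Data.List as List using (List; []; _∷_; length; map; concatMap; filter; foldr)
open import Data.List.Relation.Unary.Any using (Any)
open import Data.List.Relation.Unary.All using (All)
open import Data.List.Relation.Unary.AllPairs using (AllPairs)
open import Data.Product using (_×_; _,_; ∃; ∃-syntax; proj₁; proj₂)
open import Data.Vec.Functional as VF using (Vector)
open import Relation.Nullary using (¬_; Dec)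
open import Relation.Binary using (Decidable)
open import Algebra.Bundles using (CommutativeRing)
open import Data.Nat.Primality using (Prime)
import Data.Nat.ListAction as LA
open import Relation.Binary.PropositionalEquality using (_≡_)

IsPrimePower : ℕ → Set
IsPrimePower q = ∃[ p ] ∃[ k ] (Prime p × q ≡ p ℕ.^ suc k)

record FiniteField (c ℓ : Level) (q : ℕ) : Set (lsuc (c ⊔ ℓ)) where
  field
    commRing : CommutativeRing c ℓ
  open CommutativeRing commRing public
  field
    _≟_       : Decidable _≈_
    1≉0       : ¬ (1# ≈ 0#)
    inverse   : ∀ x → ¬ (x ≈ 0#) → ∃[ y ] (x * y ≈ 1#)
    elems     : List Carrier
    elems-len : length elems ≡ q
    complete  : ∀ x → Any (x ≈_) elems
    distinct  : AllPairs (λ a b → ¬ (a ≈ b)) elems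

module _ {c ℓ : Level} {q : ℕ} (𝔽 : FiniteField c ℓ q) where
  open FiniteField 𝔽

  pow : Carrier → ℕ → Carrier
  pow x zero    = 1#
  pow x (suc k) = x * pow x k

  sumF : List Carrier → Carrier
  sumF = foldr _+_ 0#

  prodF : List Carrier → Carrier
  prodF = foldr _*_ 1#

  Σ[<_]_ : (k : ℕ) → (Fin k → Carrier) → Carrier
  Σ[< k ] f = sumF (List.tabulate f)

  Π[<_]_ : (k : ℕ) → (Fin k → Carrier) → Carrier
  Π[< k ] f = prodF (List.tabulate f)

  allFuns : ∀ {a} {A : Set a} (k : ℕ) → List A → List (Fin k → A)
  allFuns zero    xs = (λ ()) ∷ []
  allFuns (suc k) xs =
    concatMap (λ a → map (λ f → VF._∷_ a f) (allFuns k xs)) xs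

  points : (k : ℕ) → List (Vector Carrier k)
  points k = allFuns k elems

  -- Multivariate polynomials over 𝔽_q in n variables, in monomial form:
  -- a finite list of terms (coefficient, exponent vector).
  Poly : ℕ → Set c
  Poly n = List (Carrier × (Fin n → ℕ))

  evalMono : ∀ {n} → (Fin n → ℕ) → Vector Carrier n → Carrier
  evalMono {n} e x = Π[< n ] (λ i → pow (x i) (e i))

  eval : ∀ {n} → Poly n → Vector Carrier n → Carrier
  eval p x = sumF (map (λ t → proj₁ t * evalMono (proj₂ t) x) p)

  monoDeg : ∀ {n} → (Fin n → ℕ) → ℕ
  monoDeg {n} e = LA.sum (List.tabulate e)

  DegLe : ∀ {n} → Poly n → ℕ → Set c
  DegLe p d = All (λ t → monoDeg (proj₂ t) ≤ d) p

  Fval : ∀ {n m} → (Fin m → Poly n) → Vector Carrier n → Carrier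
  Fval {m = m} P x = Π[< m ] (λ i → 1# - pow (eval (P i) x) (q ℕ.∸ 1))

  Zval : ∀ {k β m} → (Fin m → Poly (k ℕ.+ β)) → Vector Carrier k → Carrier
  Zval {β = β} P y = sumF (map (λ z → Fval P (y VF.++ z)) (points β))

  scale : ∀ {n} → Carrier → Poly n → Poly n
  scale a p = map (λ t → (a * proj₁ t , proj₂ t)) p

  combine : ∀ {n m r} → (Fin r → Fin m → Carrier) → (Fin m → Poly n) → Fin r → Poly n
  combine {m = m} ρ P i = concatMap (λ k → scale (ρ i k) (P k)) (List.allFin m)

  -- the finite uniform sample space of coefficient matrices ρ ∈ 𝔽_q^{r × m}
  rhoSpace : (r m : ℕ) → List (Fin r → Fin m → Carrier)
  rhoSpace r m = allFuns r (points m)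

  badCount : ∀ {k β m} → (Fin m → Poly (k ℕ.+ β)) → Vector Carrier k → ℕ
  badCount {k} {β} {m} P y =
    length (filter (λ ρ → Relation.Nullary.¬? (Zval (combine ρ P) y ≟ Zval P y))
                   (rhoSpace (β ℕ.+ 2) m))

-- Fix y and a point x = (y, z).  If every P_j vanishes at x then so does every P̃_i, and
-- F(x) = F̃(x) = 1.  Otherwise F(x) = 0 by Fermat's little theorem a^(q-1) = 1 (a ≠ 0), and
-- F̃(x) = 0 as well unless all β + 2 rows of ρ are orthogonal to the nonzero vector
-- (P_1(x), …, P_m(x)).  So Z̃_β(y) ≠ Z_β(y) forces such an undetected z.  For a fixed nonzero
-- vector a uniform row is orthogonal to it with probability 1/q, hence all independent rows
-- are with probability q^-(β+2), and the union bound over the q^β choices of z gives q^-2.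

module Submission where

open import Defs
open import Level using (Level)
open import Data.Nat using (ℕ; zero; suc; _≤_; _∸_; z≤n; s≤s; NonZero; >-nonZero)
import Data.Nat as ℕ
import Data.Nat.Properties as ℕₚ
open import Data.Nat.ListAction using (sum)
open import Data.Fin using (Fin; zero; suc)
open import Data.Fin.Properties using (all?; any?; ¬∀⟶∃¬)
open import Data.Vec.Functional using (Vector)
import Data.Vec.Functional as Vector
open import Data.List using (List; []; _∷_; _++_; map; concatMap; tabulate; allFin; length; filter)
open import Data.List.Properties
  using (filter-some; filter-none; filter-++; length-filter; length-++; length-map; map-++; map-cong; map-tabulate)
open import Data.List.Relation.Unary.All as All using (All; []; _∷_)
open import Data.List.Relation.Unary.All.Properties using (¬Any⇒All¬)
open import Data.List.Relation.Unary.Any as Any using (Any; here; there)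
import Data.List.Relation.Unary.Any.Properties as Any
open import Data.List.Relation.Unary.AllPairs as AllPairs using (AllPairs; []; _∷_)
import Data.List.Relation.Unary.AllPairs.Properties as AllPairs
open import Data.List.Relation.Binary.Permutation.Setoid.Properties using (foldr-commMonoid; map⁺)
open import Data.Empty using (⊥-elim)
open import Data.Product using (∃-syntax; _×_; _,_; proj₁; proj₂)
open import Function using (_∘_)
open import Relation.Binary.Bundles using (Setoid)
open import Relation.Binary.PropositionalEquality as ≡ using (_≡_)
import Relation.Binary.Reasoning.Setoid as ≈-Reasoning
open import Relation.Nullary using (¬_; yes; no; ¬?; contradiction)
open import Relation.Nullary.Decidable using (_×-dec_; decidable-stable)
open import Relation.Unary using (Pred; Decidable; _⊆_)
open import Relation.Unary.Properties using (_∪?_; ∁?)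

module Counting where
  open import Data.Nat using (_+_; _*_)
  open ℕₚ

  private variable
    a b p r : Level
    A B : Set a

  count : {P : Pred A p} → Decidable P → List A → ℕ
  count P? xs = length (filter P? xs)

  module _ {P : Pred A p} (P? : Decidable P) where

    count-++ : ∀ xs ys → count P? (xs ++ ys) ≡ count P? xs + count P? ys
    count-++ xs ys = ≡.trans (≡.cong length (filter-++ P? xs ys)) (length-++ (filter P? xs))

    count-map : (f : B → A) → ∀ xs → count P? (map f xs) ≡ count (P? ∘ f) xs
    count-map f []       = ≡.refl
    count-map f (x ∷ xs) with P? (f x)
    ... | yes _ = ≡.cong suc (count-map f xs)
    ... | no _  = count-map f xs

    count-concatMap : (f : B → List A) → ∀ xs → count P? (concatMap f xs) ≡ sum (map (count P? ∘ f) xs)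
    count-concatMap f []       = ≡.refl
    count-concatMap f (x ∷ xs) =
      ≡.trans (count-++ (f x) (concatMap f xs)) (≡.cong (count P? (f x) +_) (count-concatMap f xs))

    count-none : (∀ {x} → ¬ P x) → ∀ xs → count P? xs ≡ 0
    count-none ¬P xs = ≡.cong length (filter-none P? (All.universal (λ _ → ¬P) xs))

    count-+-count-∁ : ∀ xs → count P? xs + count (∁? P?) xs ≡ length xs
    count-+-count-∁ []       = ≡.refl
    count-+-count-∁ (x ∷ xs) with P? x
    ... | yes _ = ≡.cong suc (count-+-count-∁ xs)
    ... | no _  = ≡.trans (+-suc _ _) (≡.cong suc (count-+-count-∁ xs))

    count-≤1 : {R : A → A → Set r} → (∀ {x y} → P x → P y → ¬ R x y) →
               ∀ {xs} → AllPairs R xs → count P? xs ≤ 1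
    count-≤1 unique []                         = z≤n
    count-≤1 unique {x ∷ xs} (x≁xs ∷ xs-apart) with P? x
    ... | yes px = s≤s (≤-reflexive (≡.cong length
                     (filter-none P? (All.map (λ x≁y py → unique px py x≁y) x≁xs))))
    ... | no _   = count-≤1 unique xs-apart

  count-mono : {P : Pred A p} {Q : Pred A r} (P? : Decidable P) (Q? : Decidable Q) →
               P ⊆ Q → ∀ xs → count P? xs ≤ count Q? xs
  count-mono P? Q? P⊆Q []       = z≤n
  count-mono P? Q? P⊆Q (x ∷ xs) with P? x | Q? x
  ... | yes _  | yes _  = s≤s (count-mono P? Q? P⊆Q xs)
  ... | yes px | no ¬qx = contradiction (P⊆Q px) ¬qx
  ... | no _   | yes _  = m≤n⇒m≤1+n (count-mono P? Q? P⊆Q xs)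
  ... | no _   | no _   = count-mono P? Q? P⊆Q xs

  count-∪ : {P : Pred A p} {Q : Pred A r} (P? : Decidable P) (Q? : Decidable Q) →
            ∀ xs → count (P? ∪? Q?) xs ≤ count P? xs + count Q? xs
  count-∪ P? Q? []       = z≤n
  count-∪ P? Q? (x ∷ xs) with P? x | Q? x
  ... | yes _ | yes _ = s≤s (≤-trans (count-∪ P? Q? xs) (+-monoʳ-≤ _ (n≤1+n _)))
  ... | yes _ | no _  = s≤s (count-∪ P? Q? xs)
  ... | no _  | yes _ = ≤-trans (s≤s (count-∪ P? Q? xs)) (≤-reflexive (≡.sym (+-suc _ _)))
  ... | no _  | no _  = count-∪ P? Q? xs

  count-any≤sum-count : ∀ {C : Set b} {P : C → Pred A p} (P? : ∀ c → Decidable (P c)) →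
                        ∀ cs xs → count (λ x → Any.any? (λ c → P? c x) cs) xs
                                  ≤ sum (map (λ c → count (P? c) xs) cs)
  count-any≤sum-count P? []       xs = ≤-reflexive (count-none _ (λ ()) xs)
  count-any≤sum-count P? (c ∷ cs) xs = begin
    count (λ x → Any.any? (λ c → P? c x) (c ∷ cs)) xs
      ≤⟨ count-mono _ (P? c ∪? λ x → Any.any? (λ c → P? c x) cs) Any.toSum xs ⟩
    count (P? c ∪? λ x → Any.any? (λ c → P? c x) cs) xs
      ≤⟨ count-∪ (P? c) _ xs ⟩
    count (P? c) xs + count (λ x → Any.any? (λ c → P? c x) cs) xs
      ≤⟨ +-monoʳ-≤ _ (count-any≤sum-count P? cs xs) ⟩
    sum (map (λ c → count (P? c) xs) (c ∷ cs))
      ∎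
    where open ≤-Reasoning

  length-concatMap : (f : B → List A) → ∀ xs → length (concatMap f xs) ≡ sum (map (length ∘ f) xs)
  length-concatMap f []       = ≡.refl
  length-concatMap f (x ∷ xs) =
    ≡.trans (length-++ (f x)) (≡.cong (length (f x) +_) (length-concatMap f xs))

  sum-map-const : (f : A → ℕ) {c : ℕ} → (∀ x → f x ≡ c) → ∀ xs → sum (map f xs) ≡ length xs * c
  sum-map-const f f≡c []       = ≡.refl
  sum-map-const f f≡c (x ∷ xs) = ≡.cong₂ _+_ (f≡c x) (sum-map-const f f≡c xs)

  sum-map-≤ : (f : A → ℕ) {c : ℕ} → (∀ x → f x ≤ c) → ∀ xs → sum (map f xs) ≤ length xs * c
  sum-map-≤ f f≤c []       = z≤n
  sum-map-≤ f f≤c (x ∷ xs) = +-mono-≤ (f≤c x) (sum-map-≤ f f≤c xs)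

  sum-map-*-≤ : (f : A → ℕ) {c d : ℕ} → (∀ x → f x * c ≤ d) → ∀ xs → sum (map f xs) * c ≤ length xs * d
  sum-map-*-≤ f     fc≤d []       = z≤n
  sum-map-*-≤ f {c} fc≤d (x ∷ xs) =
    ≤-trans (≤-reflexive (*-distribʳ-+ c (f x) _)) (+-mono-≤ (fc≤d x) (sum-map-*-≤ f fc≤d xs))

  sum-map-≤-count : {P : Pred A p} (P? : Decidable P) (f : A → ℕ) {c : ℕ} →
                    (∀ {x} → P x → f x ≤ c) → (∀ {x} → ¬ P x → f x ≡ 0) →
                    ∀ xs → sum (map f xs) ≤ count P? xs * c
  sum-map-≤-count P? f f≤c f≡0 []       = z≤n
  sum-map-≤-count P? f f≤c f≡0 (x ∷ xs) with P? x
  ... | yes px = +-mono-≤ (f≤c px) (sum-map-≤-count P? f f≤c f≡0 xs)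
  ... | no ¬px = ≤-trans (≤-reflexive (≡.cong (_+ sum (map f xs)) (f≡0 ¬px)))
                         (sum-map-≤-count P? f f≤c f≡0 xs)

open Counting

module _ {c ℓ : Level} (S : Setoid c ℓ) where
  open Setoid S
  open import Data.List.Membership.Setoid S using (_∈_)
  open import Data.List.Membership.Setoid.Properties using (∈-∃++)
  open import Data.List.Relation.Unary.Unique.Setoid S using (Unique)
  open import Data.List.Relation.Binary.Permutation.Setoid S
    using (_↭_; ↭-refl; ↭-prep; ↭-trans; ↭-sym; ↭-reflexive-≋)
  open import Data.List.Relation.Binary.Permutation.Setoid.Properties S
    using (shift; ∈-resp-↭; Unique-resp-↭)

  unique-⊆-⊇⇒↭ : ∀ {xs ys} → Unique xs → Unique ys →
                 (∀ {z} → z ∈ xs → z ∈ ys) → (∀ {z} → z ∈ ys → z ∈ xs) → xs ↭ ys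
  unique-⊆-⊇⇒↭ {[]}    {[]}     _ _ _ _     = ↭-refl
  unique-⊆-⊇⇒↭ {[]}    {y ∷ ys} _ _ _ ys⊆[] with () ← ys⊆[] (here refl)
  unique-⊆-⊇⇒↭ {x ∷ xs} {ys} (x∉xs ∷ xs-unique) ys-unique xs⊆ys ys⊆xs
    with as , bs , w , x≈w , ys≋ ← ∈-∃++ S (xs⊆ys (here refl)) =
    ↭-trans (↭-prep x (unique-⊆-⊇⇒↭ xs-unique (AllPairs.tail ys′-unique) xs⊆ys′ ys′⊆xs))
            (↭-sym ys↭x∷ys′)
    where
      ys↭x∷ys′ : ys ↭ x ∷ (as ++ bs)
      ys↭x∷ys′ = ↭-trans (↭-reflexive-≋ ys≋) (shift (sym x≈w) as bs)
      ys′-unique : Unique (x ∷ (as ++ bs))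
      ys′-unique = Unique-resp-↭ ys↭x∷ys′ ys-unique
      xs⊆ys′ : ∀ {z} → z ∈ xs → z ∈ as ++ bs
      xs⊆ys′ z∈xs with ∈-resp-↭ ys↭x∷ys′ (xs⊆ys (there z∈xs))
      ... | here z≈x    = ⊥-elim (All.lookupWith (λ x≉y z≈y → x≉y (trans (sym z≈x) z≈y)) x∉xs z∈xs)
      ... | there z∈ys′ = z∈ys′
      ys′⊆xs : ∀ {z} → z ∈ as ++ bs → z ∈ xs
      ys′⊆xs z∈ys′ with ys⊆xs (∈-resp-↭ (↭-sym ys↭x∷ys′) (there z∈ys′))
      ... | here z≈x   = ⊥-elim (All.lookupWith (λ x≉y z≈y → x≉y (trans (sym z≈x) z≈y))
                                                (AllPairs.head ys′-unique) z∈ys′)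
      ... | there z∈xs = z∈xs

module _ {c ℓ : Level} {q : ℕ} (𝔽 : FiniteField c ℓ q) where
  open FiniteField 𝔽 hiding (zero)
  open import Data.List.Relation.Binary.Permutation.Setoid setoid using (_↭_)
  open import Algebra.Properties.Ring ring using (-0#≈0#)
  open import Algebra.Properties.CommutativeSemigroup *-commutativeSemigroup
    using (interchange; x∙yz≈y∙xz)

  inverse-cancel : ∀ {a b} → a * b ≈ 1# → ∀ x → b * (a * x) ≈ x
  inverse-cancel {a} {b} ab≈1 x = begin
    b * (a * x)   ≈⟨ *-assoc b a x ⟨
    (b * a) * x   ≈⟨ *-congʳ (trans (*-comm b a) ab≈1) ⟩
    1# * x        ≈⟨ *-identityˡ x ⟩
    x             ∎
    where open ≈-Reasoning setoid

  *-cancelˡ-≉0 : ∀ {a x y} → a ≉ 0# → a * x ≈ a * y → x ≈ y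
  *-cancelˡ-≉0 {a} {x} {y} a≉0 ax≈ay with b , ab≈1 ← inverse a a≉0 = begin
    x             ≈⟨ inverse-cancel ab≈1 x ⟨
    b * (a * x)   ≈⟨ *-congˡ ax≈ay ⟩
    b * (a * y)   ≈⟨ inverse-cancel ab≈1 y ⟩
    y             ∎
    where open ≈-Reasoning setoid

  *-≉0 : ∀ {a b} → a ≉ 0# → b ≉ 0# → a * b ≉ 0#
  *-≉0 {a} a≉0 b≉0 ab≈0 = b≉0 (*-cancelˡ-≉0 a≉0 (trans ab≈0 (sym (zeroʳ a))))

  pow-cong : ∀ {a b} n → a ≈ b → pow 𝔽 a n ≈ pow 𝔽 b n
  pow-cong zero    a≈b = refl
  pow-cong (suc n) a≈b = *-cong a≈b (pow-cong n a≈b)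

  isZero? : Decidable (_≈ 0#)
  isZero? a = a ≟ 0#

  count-zero-elems : count isZero? elems ≡ 1
  count-zero-elems = ℕₚ.≤-antisym
    (count-≤1 isZero? (λ a≈0 b≈0 a≉b → a≉b (trans a≈0 (sym b≈0))) distinct)
    (filter-some isZero? (Any.map sym (complete 0#)))

  count-nonzero-elems : count (∁? isZero?) elems ≡ q ∸ 1
  count-nonzero-elems = ≡.cong (_∸ 1) (begin
    suc N                        ≡⟨ ≡.cong (ℕ._+ N) count-zero-elems ⟨
    count isZero? elems ℕ.+ N    ≡⟨ count-+-count-∁ isZero? elems ⟩
    length elems                 ≡⟨ elems-len ⟩
    q                            ∎)
    where
      open ≡.≡-Reasoning
      N = count (∁? isZero?) elems

  1≤q∸1 : 1 ≤ q ∸ 1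
  1≤q∸1 = ≡.subst (1 ≤_) count-nonzero-elems
            (filter-some (∁? isZero?) (Any.map (λ 1≈a a≈0 → 1≉0 (trans 1≈a a≈0)) (complete 1#)))

  q-nonZero : NonZero q
  q-nonZero = >-nonZero (ℕₚ.≤-trans 1≤q∸1 (ℕₚ.m∸n≤m q 1))

  unitPart : Carrier → Carrier
  unitPart a with a ≟ 0#
  ... | yes _ = 1#
  ... | no _  = a

  unitPart≉0 : ∀ a → unitPart a ≉ 0#
  unitPart≉0 a with a ≟ 0#
  ... | yes _  = 1≉0
  ... | no a≉0 = a≉0

  unitPart-cong : ∀ {a b} → a ≈ b → unitPart a ≈ unitPart b
  unitPart-cong {a} {b} a≈b with a ≟ 0# | b ≟ 0#
  ... | yes _   | yes _   = refl
  ... | yes a≈0 | no b≉0  = ⊥-elim (b≉0 (trans (sym a≈b) a≈0))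
  ... | no a≉0  | yes b≈0 = ⊥-elim (a≉0 (trans a≈b b≈0))
  ... | no _    | no _    = a≈b

  unitPart-zero : ∀ {a} → a ≈ 0# → unitPart a ≈ 1#
  unitPart-zero {a} a≈0 with a ≟ 0#
  ... | yes _  = refl
  ... | no a≉0 = ⊥-elim (a≉0 a≈0)

  unitPart-nonzero : ∀ {a} → a ≉ 0# → unitPart a ≈ a
  unitPart-nonzero {a} a≉0 with a ≟ 0#
  ... | yes a≈0 = ⊥-elim (a≉0 a≈0)
  ... | no _    = refl

  prodF-unitPart-≉0 : ∀ as → prodF 𝔽 (map unitPart as) ≉ 0#
  prodF-unitPart-≉0 []       = 1≉0
  prodF-unitPart-≉0 (a ∷ as) = *-≉0 (unitPart≉0 a) (prodF-unitPart-≉0 as)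

  prodF-unitPart-scale : ∀ {x} → x ≉ 0# → ∀ as →
    prodF 𝔽 (map unitPart (map (x *_) as)) ≈ pow 𝔽 x (count (∁? isZero?) as) * prodF 𝔽 (map unitPart as)
  prodF-unitPart-scale x≉0 [] = sym (*-identityˡ 1#)
  prodF-unitPart-scale {x} x≉0 (a ∷ as) with a ≟ 0#
  ... | yes a≈0 = trans
    (*-cong (unitPart-zero (trans (*-congˡ a≈0) (zeroʳ x))) (prodF-unitPart-scale x≉0 as))
    (x∙yz≈y∙xz 1# _ _)
  ... | no a≉0  = trans
    (*-cong (unitPart-nonzero (*-≉0 x≉0 a≉0)) (prodF-unitPart-scale x≉0 as))
    (interchange x a _ _)

  scale-elems-↭ : ∀ {x} → x ≉ 0# → map (x *_) elems ↭ elems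
  scale-elems-↭ {x} x≉0 = unique-⊆-⊇⇒↭ setoid
    (AllPairs.map⁺ (AllPairs.map (λ a≉b xa≈xb → a≉b (*-cancelˡ-≉0 x≉0 xa≈xb)) distinct))
    distinct
    (λ {z} _ → complete z)
    (λ {z} _ → Any.map⁺ (Any.map (λ y*z≈a → trans (sym (x*[y*z]≈z z)) (*-congˡ y*z≈a)) (complete (y * z))))
    where
      y = proj₁ (inverse x x≉0)
      x*[y*z]≈z : ∀ z → x * (y * z) ≈ z
      x*[y*z]≈z = inverse-cancel (trans (*-comm y x) (proj₂ (inverse x x≉0)))

  -- Multiplication by x permutes 𝔽 and rescales exactly the q - 1 nonzero factors of the
  -- product of all unit parts.
  fermat : ∀ {x} → x ≉ 0# → pow 𝔽 x (q ∸ 1) ≈ 1#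
  fermat {x} x≉0 = sym (*-cancelˡ-≉0 (prodF-unitPart-≉0 elems) (begin
    Π * 1#                                     ≈⟨ *-identityʳ Π ⟩
    Π                                          ≈⟨ foldr-commMonoid setoid *-isCommutativeMonoid
                                                    (map⁺ setoid setoid unitPart-cong (scale-elems-↭ x≉0)) ⟨
    prodF 𝔽 (map unitPart (map (x *_) elems)) ≈⟨ prodF-unitPart-scale x≉0 elems ⟩
    pow 𝔽 x (count (∁? isZero?) elems) * Π    ≡⟨ ≡.cong (λ n → pow 𝔽 x n * Π) count-nonzero-elems ⟩
    pow 𝔽 x (q ∸ 1) * Π                       ≈⟨ *-comm _ Π ⟩
    Π * pow 𝔽 x (q ∸ 1)                       ∎))
    where
      open ≈-Reasoning setoid
      Π = prodF 𝔽 (map unitPart elems)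

  pow-0# : ∀ {n} → 1 ≤ n → pow 𝔽 0# n ≈ 0#
  pow-0# (s≤s _) = zeroˡ _

  1-pow-zero : ∀ {a} → a ≈ 0# → 1# - pow 𝔽 a (q ∸ 1) ≈ 1#
  1-pow-zero a≈0 = begin
    1# - _    ≈⟨ +-congˡ (-‿cong (trans (pow-cong (q ∸ 1) a≈0) (pow-0# 1≤q∸1))) ⟩
    1# - 0#   ≈⟨ +-congˡ -0#≈0# ⟩
    1# + 0#   ≈⟨ +-identityʳ 1# ⟩
    1#        ∎
    where open ≈-Reasoning setoid

  1-pow-nonzero : ∀ {a} → a ≉ 0# → 1# - pow 𝔽 a (q ∸ 1) ≈ 0#
  1-pow-nonzero a≉0 = trans (+-congˡ (-‿cong (fermat a≉0))) (-‿inverseʳ 1#)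

  prodF-tabulate-≈1 : ∀ {n} (f : Fin n → Carrier) → (∀ i → f i ≈ 1#) → prodF 𝔽 (tabulate f) ≈ 1#
  prodF-tabulate-≈1 {zero}  f f≈1 = refl
  prodF-tabulate-≈1 {suc n} f f≈1 =
    trans (*-cong (f≈1 zero) (prodF-tabulate-≈1 (f ∘ suc) (f≈1 ∘ suc))) (*-identityˡ 1#)

  prodF-tabulate-≈0 : ∀ {n} (f : Fin n → Carrier) i → f i ≈ 0# → prodF 𝔽 (tabulate f) ≈ 0#
  prodF-tabulate-≈0 f zero    fi≈0 = trans (*-congʳ fi≈0) (zeroˡ _)
  prodF-tabulate-≈0 f (suc i) fi≈0 = trans (*-congˡ (prodF-tabulate-≈0 (f ∘ suc) i fi≈0)) (zeroʳ _)

  Fval-≈1 : ∀ {n m} (P : Fin m → Poly 𝔽 n) x → (∀ i → eval 𝔽 (P i) x ≈ 0#) → Fval 𝔽 P x ≈ 1#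
  Fval-≈1 P x P≈0 = prodF-tabulate-≈1 _ (λ i → 1-pow-zero (P≈0 i))

  Fval-≈0 : ∀ {n m} (P : Fin m → Poly 𝔽 n) x i → eval 𝔽 (P i) x ≉ 0# → Fval 𝔽 P x ≈ 0#
  Fval-≈0 P x i Pᵢ≉0 = prodF-tabulate-≈0 _ i (1-pow-nonzero Pᵢ≉0)

  sumF-++ : ∀ as bs → sumF 𝔽 (as ++ bs) ≈ sumF 𝔽 as + sumF 𝔽 bs
  sumF-++ []       bs = sym (+-identityˡ _)
  sumF-++ (a ∷ as) bs = trans (+-congˡ (sumF-++ as bs)) (sym (+-assoc a _ _))

  sumF-map-concatMap : ∀ {a b} {A : Set a} {B : Set b} (h : B → Carrier) (g : A → List B) xs →
                       sumF 𝔽 (map h (concatMap g xs)) ≈ sumF 𝔽 (map (λ x → sumF 𝔽 (map h (g x))) xs)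
  sumF-map-concatMap h g []       = refl
  sumF-map-concatMap h g (x ∷ xs) = begin
    sumF 𝔽 (map h (g x ++ concatMap g xs))                  ≡⟨ ≡.cong (sumF 𝔽) (map-++ h (g x) _) ⟩
    sumF 𝔽 (map h (g x) ++ map h (concatMap g xs))          ≈⟨ sumF-++ (map h (g x)) _ ⟩
    sumF 𝔽 (map h (g x)) + sumF 𝔽 (map h (concatMap g xs))  ≈⟨ +-congˡ (sumF-map-concatMap h g xs) ⟩
    sumF 𝔽 (map (λ x → sumF 𝔽 (map h (g x))) (x ∷ xs))     ∎
    where open ≈-Reasoning setoid

  sumF-map-cong : ∀ {a} {A : Set a} {f g : A → Carrier} {xs} → All (λ x → f x ≈ g x) xs →
                  sumF 𝔽 (map f xs) ≈ sumF 𝔽 (map g xs)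
  sumF-map-cong []            = refl
  sumF-map-cong (fx≈gx ∷ f≈g) = +-cong fx≈gx (sumF-map-cong f≈g)

  eval-scale : ∀ {n} a (p : Poly 𝔽 n) x → eval 𝔽 (scale 𝔽 a p) x ≈ a * eval 𝔽 p x
  eval-scale a []      x = sym (zeroʳ a)
  eval-scale a (t ∷ p) x = trans (+-cong (*-assoc _ _ _) (eval-scale a p x)) (sym (distribˡ a _ _))

  dot : ∀ {m} → Vector Carrier m → Vector Carrier m → Carrier
  dot u v = sumF 𝔽 (tabulate (λ k → u k * v k))

  dot-zeroʳ : ∀ {m} (u v : Vector Carrier m) → (∀ k → v k ≈ 0#) → dot u v ≈ 0#
  dot-zeroʳ {zero}  u v v≈0 = refl
  dot-zeroʳ {suc m} u v v≈0 = trans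
    (+-cong (trans (*-congˡ (v≈0 zero)) (zeroʳ _)) (dot-zeroʳ (u ∘ suc) (v ∘ suc) (v≈0 ∘ suc)))
    (+-identityʳ 0#)

  eval-combine : ∀ {n m r} (ρ : Fin r → Vector Carrier m) (P : Fin m → Poly 𝔽 n) i x →
                 eval 𝔽 (combine 𝔽 ρ P i) x ≈ dot (ρ i) (λ k → eval 𝔽 (P k) x)
  eval-combine {m = m} ρ P i x = begin
    eval 𝔽 (combine 𝔽 ρ P i) x
      ≈⟨ sumF-map-concatMap _ (λ k → scale 𝔽 (ρ i k) (P k)) (allFin m) ⟩
    sumF 𝔽 (map (λ k → eval 𝔽 (scale 𝔽 (ρ i k) (P k)) x) (allFin m))
      ≈⟨ sumF-map-cong (All.universal (λ k → eval-scale (ρ i k) (P k) x) (allFin m)) ⟩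
    sumF 𝔽 (map (λ k → ρ i k * eval 𝔽 (P k) x) (allFin m))
      ≡⟨ ≡.cong (sumF 𝔽) (map-tabulate (λ k → k) (λ k → ρ i k * eval 𝔽 (P k) x)) ⟩
    dot (ρ i) (λ k → eval 𝔽 (P k) x)
      ∎
    where open ≈-Reasoning setoid

open import Data.Nat using (_+_; _*_; _^_)

module _ {c ℓ : Level} {q : ℕ} (𝔽 : FiniteField c ℓ q) where
  open FiniteField 𝔽 hiding (zero) renaming (_+_ to _⊕_; _*_ to _⊗_)
  open import Algebra.Properties.Ring ring using (+-cancelˡ)

  module _ {a} {A : Set a} where

    length-allFuns : ∀ k (xs : List A) → length (allFuns 𝔽 k xs) ≡ length xs ^ k
    length-allFuns zero    xs = ≡.refl
    length-allFuns (suc k) xs = ≡.trans (length-concatMap _ xs)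
      (sum-map-const _ (λ x → ≡.trans (length-map (x Vector.∷_) (allFuns 𝔽 k xs)) (length-allFuns k xs)) xs)

    count-allFuns-suc : ∀ {p k} {P : Pred (Vector A (suc k)) p} (P? : Decidable P) (xs : List A) →
      count P? (allFuns 𝔽 (suc k) xs) ≡ sum (map (λ x → count (P? ∘ (x Vector.∷_)) (allFuns 𝔽 k xs)) xs)
    count-allFuns-suc {k = k} P? xs = ≡.trans (count-concatMap P? _ xs)
      (≡.cong sum (map-cong (λ x → count-map P? (x Vector.∷_) (allFuns 𝔽 k xs)) xs))

    count-allFuns-all : ∀ {p} {Q : Pred A p} (Q? : Decidable Q) r (xs : List A) →
                        count (λ f → all? {n = r} (Q? ∘ f)) (allFuns 𝔽 r xs) ≤ count Q? xs ^ r
    count-allFuns-all Q? zero    xs = length-filter (λ f → all? {n = 0} (Q? ∘ f)) ((λ ()) ∷ [])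
    count-allFuns-all Q? (suc r) xs = ℕₚ.≤-trans (ℕₚ.≤-reflexive (count-allFuns-suc _ xs))
      (sum-map-≤-count Q? _
        (λ _ → ℕₚ.≤-trans (count-mono _ _ (λ all-Q i → all-Q (suc i)) (allFuns 𝔽 r xs))
                          (count-allFuns-all Q? r xs))
        (λ ¬Qx → count-none _ (λ all-Q → ¬Qx (all-Q zero)) (allFuns 𝔽 r xs))
        xs)

  length-points : ∀ k → length (points 𝔽 k) ≡ q ^ k
  length-points k = ≡.trans (length-allFuns k elems) (≡.cong (_^ k) elems-len)

  -- Fibre over the first coordinate: if v has a nonzero entry past the first one, every fibre is
  -- a hyperplane in one dimension less; otherwise v₀ ≠ 0 and only the fibre of the unique root
  -- of c + a v₀ is nonempty.
  count-hyperplane : ∀ {m} (v : Vector Carrier (suc m)) → (∃[ j ] v j ≉ 0#) → ∀ c →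
                     count (λ w → (c ⊕ dot 𝔽 w v) ≟ 0#) (points 𝔽 (suc m)) ≤ q ^ m
  count-hyperplane v v≉0 c with any? (λ j → ¬? (v (suc j) ≟ 0#))
  count-hyperplane {zero}  v _ c | yes (() , _)
  count-hyperplane {suc m} v _ c | yes tail≉0 = begin
    count (λ w → (c ⊕ dot 𝔽 w v) ≟ 0#) (points 𝔽 (suc (suc m)))
      ≡⟨ count-allFuns-suc _ elems ⟩
    sum (map fibre elems)
      ≤⟨ sum-map-≤ fibre fibre≤ elems ⟩
    length elems * q ^ m
      ≡⟨ ≡.cong (_* q ^ m) elems-len ⟩
    q ^ suc m
      ∎
    where
      open ℕₚ.≤-Reasoning
      fibre : Carrier → ℕ
      fibre a = count (λ w → (c ⊕ (a ⊗ v zero ⊕ dot 𝔽 w (v ∘ suc))) ≟ 0#) (points 𝔽 (suc m))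
      fibre≤ : ∀ a → fibre a ≤ q ^ m
      fibre≤ a = ℕₚ.≤-trans (count-mono _ _ (trans (+-assoc _ _ _)) (points 𝔽 (suc m)))
                            (count-hyperplane (v ∘ suc) tail≉0 (c ⊕ a ⊗ v zero))
  count-hyperplane {m} v (j , vⱼ≉0) c | no tail≉0 = begin
    count (λ w → (c ⊕ dot 𝔽 w v) ≟ 0#) (points 𝔽 (suc m))
      ≡⟨ count-allFuns-suc _ elems ⟩
    sum (map fibre elems)
      ≤⟨ sum-map-≤-count root? fibre (λ _ → fibre≤) fibre≡0 elems ⟩
    count root? elems * q ^ m
      ≤⟨ ℕₚ.*-monoˡ-≤ _ (count-≤1 root? root-unique distinct) ⟩
    1 * q ^ m
      ≡⟨ ℕₚ.*-identityˡ _ ⟩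
    q ^ m
      ∎
    where
      open ℕₚ.≤-Reasoning
      v₀ = v zero
      v₀≉0 : v₀ ≉ 0#
      v₀≉0 = head≉0 j vⱼ≉0
        where
          head≉0 : ∀ j → v j ≉ 0# → v₀ ≉ 0#
          head≉0 zero     v₀≉0 = v₀≉0
          head≉0 (suc j′) vⱼ≉0 = contradiction (j′ , vⱼ≉0) tail≉0
      tail≈0 : ∀ w → dot 𝔽 w (v ∘ suc) ≈ 0#
      tail≈0 w = dot-zeroʳ 𝔽 w _ (λ k → decidable-stable (v (suc k) ≟ 0#) (λ vₖ≉0 → tail≉0 (k , vₖ≉0)))
      root? : Decidable (λ a → c ⊕ a ⊗ v₀ ≈ 0#)
      root? a = (c ⊕ a ⊗ v₀) ≟ 0#
      root-unique : ∀ {a b} → c ⊕ a ⊗ v₀ ≈ 0# → c ⊕ b ⊗ v₀ ≈ 0# → ¬ a ≉ b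
      root-unique {a} {b} a-root b-root a≉b = a≉b (*-cancelˡ-≉0 𝔽 v₀≉0
        (trans (*-comm v₀ a) (trans (+-cancelˡ c _ _ (trans a-root (sym b-root))) (*-comm b v₀))))
      on-plane? : ∀ a → Decidable (λ w → c ⊕ (a ⊗ v₀ ⊕ dot 𝔽 w (v ∘ suc)) ≈ 0#)
      on-plane? a w = (c ⊕ (a ⊗ v₀ ⊕ dot 𝔽 w (v ∘ suc))) ≟ 0#
      fibre : Carrier → ℕ
      fibre a = count (on-plane? a) (points 𝔽 m)
      fibre≤ : ∀ {a} → fibre a ≤ q ^ m
      fibre≤ {a} = ℕₚ.≤-trans (length-filter (on-plane? a) (points 𝔽 m)) (ℕₚ.≤-reflexive (length-points m))
      fibre≡0 : ∀ {a} → c ⊕ a ⊗ v₀ ≉ 0# → fibre a ≡ 0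
      fibre≡0 a≉root = count-none _
        (λ {w} on-plane → a≉root (trans (+-congˡ (sym (trans (+-congˡ (tail≈0 w)) (+-identityʳ _)))) on-plane))
        (points 𝔽 m)

  -- The factor q ^ r stands on the left so that the bound also covers m = 0 without a
  -- truncated q ^ (m ∸ 1).
  count-annihilators : ∀ {m} r (v : Vector Carrier m) → (∃[ j ] v j ≉ 0#) →
    count (λ ρ → all? {n = r} (λ i → dot 𝔽 (ρ i) v ≟ 0#)) (rhoSpace 𝔽 r m) * q ^ r ≤ q ^ (r * m)
  count-annihilators {zero}  r v (() , _)
  count-annihilators {suc m} r v v≉0 = begin
    count (λ ρ → all? (λ i → dot 𝔽 (ρ i) v ≟ 0#)) (rhoSpace 𝔽 r (suc m)) * q ^ r
      ≤⟨ ℕₚ.*-monoˡ-≤ _ (ℕₚ.≤-trans (count-allFuns-all _ r (points 𝔽 (suc m))) (ℕₚ.^-monoˡ-≤ r orthogonal≤)) ⟩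
    (q ^ m) ^ r * q ^ r    ≡⟨ ≡.cong (_* q ^ r) (ℕₚ.^-*-assoc q m r) ⟩
    q ^ (m * r) * q ^ r    ≡⟨ ℕₚ.^-distribˡ-+-* q (m * r) r ⟨
    q ^ (m * r + r)        ≡⟨ ≡.cong (q ^_) (≡.trans (ℕₚ.+-comm (m * r) r) (≡.cong (r +_) (ℕₚ.*-comm m r))) ⟩
    q ^ (r + r * m)        ≡⟨ ≡.cong (q ^_) (ℕₚ.*-suc r m) ⟨
    q ^ (r * suc m)        ∎
    where
      open ℕₚ.≤-Reasoning
      orthogonal≤ : count (λ w → dot 𝔽 w v ≟ 0#) (points 𝔽 (suc m)) ≤ q ^ m
      orthogonal≤ = ℕₚ.≤-trans (count-mono _ _ (trans (+-identityˡ _)) (points 𝔽 (suc m)))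
                               (count-hyperplane v v≉0 0#)

module _ {c ℓ : Level} {q : ℕ} (𝔽 : FiniteField c ℓ q) {n m : ℕ} (P : Fin m → Poly 𝔽 n) where
  open FiniteField 𝔽 using (Carrier; _≈_; _≉_; _≟_; 0#; sym; trans)

  values : Vector Carrier n → Vector Carrier m
  values x j = eval 𝔽 (P j) x

  Undetected : ∀ {r} → Vector Carrier n → (Fin r → Vector Carrier m) → Set ℓ
  Undetected x ρ = (∃[ j ] values x j ≉ 0#) × (∀ i → dot 𝔽 (ρ i) (values x) ≈ 0#)

  undetected? : ∀ {r} x → Decidable (Undetected {r} x)
  undetected? x ρ = any? (λ j → ¬? (values x j ≟ 0#)) ×-dec all? (λ i → dot 𝔽 (ρ i) (values x) ≟ 0#)

  Fval-combine : ∀ {r} (ρ : Fin r → Vector Carrier m) x → ¬ Undetected x ρ →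
                 Fval 𝔽 (combine 𝔽 ρ P) x ≈ Fval 𝔽 P x
  Fval-combine ρ x detected with all? (λ j → values x j ≟ 0#)
  ... | yes P≈0 = trans
    (Fval-≈1 𝔽 (combine 𝔽 ρ P) x (λ i → trans (eval-combine 𝔽 ρ P i x) (dot-zeroʳ 𝔽 (ρ i) _ P≈0)))
    (sym (Fval-≈1 𝔽 P x P≈0))
  ... | no ¬P≈0
    with j , Pⱼ≉0 ← ¬∀⟶∃¬ m _ (λ j → values x j ≟ 0#) ¬P≈0
    with i , ρᵢ≉0 ← ¬∀⟶∃¬ _ _ (λ i → dot 𝔽 (ρ i) (values x) ≟ 0#) (λ ρ⊥ → detected ((j , Pⱼ≉0) , ρ⊥)) = trans
    (Fval-≈0 𝔽 (combine 𝔽 ρ P) x i (λ P̃ᵢ≈0 → ρᵢ≉0 (trans (sym (eval-combine 𝔽 ρ P i x)) P̃ᵢ≈0)))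
    (sym (Fval-≈0 𝔽 P x j Pⱼ≉0))

  count-undetected : ∀ r x → count (undetected? {r} x) (rhoSpace 𝔽 r m) * q ^ r ≤ q ^ (r * m)
  count-undetected r x with any? (λ j → ¬? (values x j ≟ 0#))
  ... | yes P≉0 = ℕₚ.≤-trans (ℕₚ.*-monoˡ-≤ _ (count-mono _ _ proj₂ (rhoSpace 𝔽 r m)))
                             (count-annihilators 𝔽 r (values x) P≉0)
  ... | no ¬P≉0 = ≡.subst (λ k → k * q ^ r ≤ q ^ (r * m))
                          (≡.sym (count-none _ (¬P≉0 ∘ proj₁) (rhoSpace 𝔽 r m))) z≤n

module _ {c ℓ : Level} {q : ℕ} (𝔽 : FiniteField c ℓ q) {k β m : ℕ} (P : Fin m → Poly 𝔽 (k + β))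
         (y : Vector (FiniteField.Carrier 𝔽) k) where
  open FiniteField 𝔽 using (Carrier; _≉_)

  Zval-differs⇒undetected : ∀ {r} (ρ : Fin r → Vector Carrier m) → Zval 𝔽 (combine 𝔽 ρ P) y ≉ Zval 𝔽 P y →
                            Any (λ z → Undetected 𝔽 P (y Vector.++ z) ρ) (points 𝔽 β)
  Zval-differs⇒undetected ρ Z̃≉Z with Any.any? (λ z → undetected? 𝔽 P (y Vector.++ z) ρ) (points 𝔽 β)
  ... | yes undetected = undetected
  ... | no  detected   = ⊥-elim (Z̃≉Z (sumF-map-cong 𝔽
          (All.map (λ {z} → Fval-combine 𝔽 P ρ (y Vector.++ z)) (¬Any⇒All¬ (points 𝔽 β) detected))))

  badCount-bound : badCount 𝔽 P y * q ^ (β + 2) ≤ q ^ β * q ^ ((β + 2) * m)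
  badCount-bound = begin
    badCount 𝔽 P y * q ^ (β + 2)
      ≤⟨ ℕₚ.*-monoˡ-≤ _ (count-mono _ _ (Zval-differs⇒undetected _) ρs) ⟩
    count (λ ρ → Any.any? (λ z → undetected? 𝔽 P (y Vector.++ z) ρ) (points 𝔽 β)) ρs * q ^ (β + 2)
      ≤⟨ ℕₚ.*-monoˡ-≤ _ (count-any≤sum-count (λ z → undetected? 𝔽 P (y Vector.++ z)) (points 𝔽 β) ρs) ⟩
    sum (map (λ z → count (undetected? 𝔽 P (y Vector.++ z)) ρs) (points 𝔽 β)) * q ^ (β + 2)
      ≤⟨ sum-map-*-≤ _ (λ z → count-undetected 𝔽 P (β + 2) (y Vector.++ z)) (points 𝔽 β) ⟩
    length (points 𝔽 β) * q ^ ((β + 2) * m)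
      ≡⟨ ≡.cong (_* _) (length-points 𝔽 β) ⟩
    q ^ β * q ^ ((β + 2) * m)
      ∎
    where
      open ℕₚ.≤-Reasoning
      ρs = rhoSpace 𝔽 (β + 2) m

lemma3p6 : ∀ {c ℓ : Level} (q : ℕ) → IsPrimePower q → (𝔽 : FiniteField c ℓ q)
         → (k β m d : ℕ) (P : Fin m → Poly 𝔽 (k + β))
         → (∀ i → DegLe 𝔽 (P i) d)
         → (y : Vector (FiniteField.Carrier 𝔽) k)
         → badCount 𝔽 P y * q ^ 2 ≤ q ^ ((β + 2) * m)
lemma3p6 q _ 𝔽 k β m d P _ y = ℕₚ.*-cancelˡ-≤ (q ^ β) {{ℕₚ.m^n≢0 q β {{q-nonZero 𝔽}}}} (begin
  q ^ β * (badCount 𝔽 P y * q ^ 2)   ≡⟨ x∙yz≈y∙xz (q ^ β) (badCount 𝔽 P y) (q ^ 2) ⟩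
  badCount 𝔽 P y * (q ^ β * q ^ 2)   ≡⟨ ≡.cong (badCount 𝔽 P y *_) (ℕₚ.^-distribˡ-+-* q β 2) ⟨
  badCount 𝔽 P y * q ^ (β + 2)       ≤⟨ badCount-bound 𝔽 P y ⟩
  q ^ β * q ^ ((β + 2) * m)          ∎)
  where
    open ℕₚ.≤-Reasoning
    open import Algebra.Properties.CommutativeSemigroup ℕₚ.*-commutativeSemigroup using (x∙yz≈y∙xz)
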